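{- For a Boolean kit $(\mathbb{A},\mathcal{A})$, the full embedding $\mathrm{StPSh}(\mathbb{A},\mathcal{A})\hookrightarrow\mathrm{PSh}(\mathbb{A})$ creates isomorphisms, coproducts, filtered colimits, epimorphisms and non-empty limits.
   Context: A kit on a groupoid $\mathbb{A}$ is a family $\mathcal{A}(a)$ of sets of subgroups of $\mathrm{End}(a)=\mathbb{A}(a,a)$ closed under conjugation. Subgroups $H,K$ of $\mathrm{End}(a)$ are orthogonal if $H\cap K=\{\mathrm{id}\}$; $\mathcal{A}^\perp$ is the kit on $\mathbb{A}^{op}$ with $\mathcal{A}^\perp(a)$ the subgroups orthogonal to all members of $\mathcal{A}(a)$; the kit is Boolean if $\mathcal{A}=\mathcal{A}^{\perp\perp}$. $\mathrm{StPSh}(\mathbb{A},\mathcal{A})$ is the full subcategory of presheaves $X:\mathbb{A}^{op}\to\mathbf{Set}$ such that for all $a$ and $x\in X(a)$ the stabilizer $\{\alpha\in\mathrm{End}(a):x\cdot\alpha=x\}$ belongs to $\mathcal{A}(a)$. -}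

module Defs where

open import Level using (Level; 0ℓ; _⊔_) renaming (suc to lsuc)
open import Data.Product using (Σ; Σ-syntax; _×_; _,_; proj₁; proj₂)
open import Relation.Binary.Bundles using (Setoid)
open import Relation.Binary.Structures using (IsEquivalence)
open import Relation.Binary.PropositionalEquality using (_≡_; refl; subst)
open import Function.Bundles using (_⇔_)

record Category (o ℓ e : Level) : Set (lsuc (o ⊔ ℓ ⊔ e)) where
  infixr 9 _∘_
  infix 4 _≈_
  field
    Obj  : Set o
    _⇒_  : Obj → Obj → Set ℓ
    _≈_  : ∀ {A B} → A ⇒ B → A ⇒ B → Set e
    id   : ∀ {A} → A ⇒ A
    _∘_  : ∀ {A B C} → B ⇒ C → A ⇒ B → A ⇒ C
    equiv     : ∀ {A B} → IsEquivalence (_≈_ {A} {B})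
    assoc     : ∀ {A B C D} {f : A ⇒ B} {g : B ⇒ C} {h : C ⇒ D} →
                (h ∘ g) ∘ f ≈ h ∘ (g ∘ f)
    identityˡ : ∀ {A B} {f : A ⇒ B} → id ∘ f ≈ f
    identityʳ : ∀ {A B} {f : A ⇒ B} → f ∘ id ≈ f
    ∘-resp-≈  : ∀ {A B C} {f h : B ⇒ C} {g i : A ⇒ B} →
                f ≈ h → g ≈ i → f ∘ g ≈ h ∘ i

record Functor {o ℓ e o′ ℓ′ e′ : Level}
               (C : Category o ℓ e) (D : Category o′ ℓ′ e′)
               : Set (o ⊔ ℓ ⊔ e ⊔ o′ ⊔ ℓ′ ⊔ e′) where
  private
    module C = Category C
    module D = Category D
  field
    F₀ : C.Obj → D.Obj
    F₁ : ∀ {A B} → A C.⇒ B → F₀ A D.⇒ F₀ B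
    identity     : ∀ {A} → F₁ (C.id {A}) D.≈ D.id
    homomorphism : ∀ {X Y Z} {f : X C.⇒ Y} {g : Y C.⇒ Z} →
                   F₁ (g C.∘ f) D.≈ (F₁ g D.∘ F₁ f)
    F-resp-≈     : ∀ {A B} {f g : A C.⇒ B} → f C.≈ g → F₁ f D.≈ F₁ g

module _ {o ℓ e : Level} (C : Category o ℓ e) where
  open Category C

  IsEpi : ∀ {A B} → A ⇒ B → Set (o ⊔ ℓ ⊔ e)
  IsEpi {A} {B} f = ∀ {Z} (g h : B ⇒ Z) → g ∘ f ≈ h ∘ f → g ≈ h

  IsIso : ∀ {A B} → A ⇒ B → Set (ℓ ⊔ e)
  IsIso {A} {B} f = Σ[ g ∈ B ⇒ A ] ((g ∘ f ≈ id) × (f ∘ g ≈ id))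

  record CoproductCocone (I : Set) (X : I → Obj) : Set (o ⊔ ℓ ⊔ e) where
    field
      apex : Obj
      inj  : (i : I) → X i ⇒ apex

  IsCoproduct : {I : Set} {X : I → Obj} → CoproductCocone I X → Set (o ⊔ ℓ ⊔ e)
  IsCoproduct {I} {X} K =
    ∀ (L : CoproductCocone I X) →
      Σ[ u ∈ CoproductCocone.apex K ⇒ CoproductCocone.apex L ]
        ((∀ i → u ∘ CoproductCocone.inj K i ≈ CoproductCocone.inj L i) ×
         (∀ (v : CoproductCocone.apex K ⇒ CoproductCocone.apex L) →
            (∀ i → v ∘ CoproductCocone.inj K i ≈ CoproductCocone.inj L i) → v ≈ u))

  module _ {o′ ℓ′ e′ : Level} {J : Category o′ ℓ′ e′} (D : Functor J C) where
    private module J = Category J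
    open Functor D

    record Cocone : Set (o ⊔ ℓ ⊔ e ⊔ o′ ⊔ ℓ′) where
      field
        apex    : Obj
        ψ       : (j : J.Obj) → F₀ j ⇒ apex
        commute : ∀ {j k} (f : j J.⇒ k) → ψ k ∘ F₁ f ≈ ψ j

    IsColimit : Cocone → Set (o ⊔ ℓ ⊔ e ⊔ o′ ⊔ ℓ′)
    IsColimit K =
      ∀ (L : Cocone) →
        Σ[ u ∈ Cocone.apex K ⇒ Cocone.apex L ]
          ((∀ j → u ∘ Cocone.ψ K j ≈ Cocone.ψ L j) ×
           (∀ (v : Cocone.apex K ⇒ Cocone.apex L) →
              (∀ j → v ∘ Cocone.ψ K j ≈ Cocone.ψ L j) → v ≈ u))

    record Cone : Set (o ⊔ ℓ ⊔ e ⊔ o′ ⊔ ℓ′) where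
      field
        apex    : Obj
        π       : (j : J.Obj) → apex ⇒ F₀ j
        commute : ∀ {j k} (f : j J.⇒ k) → F₁ f ∘ π j ≈ π k

    IsLimit : Cone → Set (o ⊔ ℓ ⊔ e ⊔ o′ ⊔ ℓ′)
    IsLimit K =
      ∀ (L : Cone) →
        Σ[ u ∈ Cone.apex L ⇒ Cone.apex K ]
          ((∀ j → Cone.π K j ∘ u ≈ Cone.π L j) ×
           (∀ (v : Cone.apex L ⇒ Cone.apex K) →
              (∀ j → Cone.π K j ∘ v ≈ Cone.π L j) → v ≈ u))

module _ {o ℓ e : Level} (J : Category o ℓ e) where
  open Category J

  record Filtered : Set (o ⊔ ℓ ⊔ e) where
    field
      inhabited : Obj
      upper     : (j k : Obj) → Σ[ l ∈ Obj ] ((j ⇒ l) × (k ⇒ l))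
      coequal   : ∀ {j k} (f g : j ⇒ k) →
                  Σ[ l ∈ Obj ] Σ[ h ∈ k ⇒ l ] (h ∘ f ≈ h ∘ g)

  NonEmpty : Set o
  NonEmpty = Obj

module _ {o ℓ e p : Level} (C : Category o ℓ e) (S : Category.Obj C → Set p) where
  open Category C

  FullSub : Category (o ⊔ p) ℓ e
  FullSub = record
    { Obj = Σ Obj S
    ; _⇒_ = λ X Y → proj₁ X ⇒ proj₁ Y
    ; _≈_ = _≈_
    ; id = id
    ; _∘_ = _∘_
    ; equiv = equiv
    ; assoc = assoc
    ; identityˡ = identityˡ
    ; identityʳ = identityʳ
    ; ∘-resp-≈ = ∘-resp-≈
    }

  private
    module E {A B : Obj} = IsEquivalence (equiv {A} {B})

  incl : Functor FullSub C
  incl = record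
    { F₀ = proj₁
    ; F₁ = λ f → f
    ; identity = E.refl
    ; homomorphism = E.refl
    ; F-resp-≈ = λ p → p
    }

  _∘incl_ : {o′ ℓ′ e′ : Level} {J : Category o′ ℓ′ e′} →
            Functor J FullSub → Functor J C
  _∘incl_ D = record
    { F₀ = λ j → proj₁ (F₀ j)
    ; F₁ = F₁
    ; identity = identity
    ; homomorphism = homomorphism
    ; F-resp-≈ = F-resp-≈
    }
    where open Functor D

  liftCocone : {o′ ℓ′ e′ : Level} {J : Category o′ ℓ′ e′} (D : Functor J FullSub) →
               (K : Cocone C (_∘incl_ D)) → S (Cocone.apex K) → Cocone FullSub D
  liftCocone D K s = record
    { apex = Cocone.apex K , s
    ; ψ = Cocone.ψ K
    ; commute = Cocone.commute K
    }

  liftCone : {o′ ℓ′ e′ : Level} {J : Category o′ ℓ′ e′} (D : Functor J FullSub) →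
             (K : Cone C (_∘incl_ D)) → S (Cone.apex K) → Cone FullSub D
  liftCone D K s = record
    { apex = Cone.apex K , s
    ; π = Cone.π K
    ; commute = Cone.commute K
    }

  liftCoproduct : {I : Set} (X : I → Σ Obj S) →
                  (K : CoproductCocone C I (λ i → proj₁ (X i))) →
                  S (CoproductCocone.apex K) → CoproductCocone FullSub I X
  liftCoproduct X K s = record
    { apex = CoproductCocone.apex K , s
    ; inj = CoproductCocone.inj K
    }

  -- "the inclusion creates ...": every such structure in C over a
  -- diagram in the subcategory lifts (necessarily uniquely, the lift
  -- being determined by the underlying data) and the lift is again such
  -- a structure in the subcategory.

  CreatesIsos : Set (o ⊔ ℓ ⊔ e ⊔ p)
  CreatesIsos =
    ∀ (X : Σ Obj S) (Y : Obj) (f : proj₁ X ⇒ Y) → IsIso C f →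
      Σ[ s ∈ S Y ] IsIso FullSub {X} {Y , s} f

  CreatesCoproducts : Set (lsuc 0ℓ ⊔ o ⊔ ℓ ⊔ e ⊔ p)
  CreatesCoproducts =
    ∀ (I : Set) (X : I → Σ Obj S)
      (K : CoproductCocone C I (λ i → proj₁ (X i))) → IsCoproduct C K →
      Σ[ s ∈ S (CoproductCocone.apex K) ]
        IsCoproduct FullSub (liftCoproduct X K s)

  CreatesFilteredColimits : Set (lsuc 0ℓ ⊔ o ⊔ ℓ ⊔ e ⊔ p)
  CreatesFilteredColimits =
    ∀ (J : Category 0ℓ 0ℓ 0ℓ) → Filtered J → (D : Functor J FullSub)
      (K : Cocone C (_∘incl_ D)) → IsColimit C (_∘incl_ D) K →
      Σ[ s ∈ S (Cocone.apex K) ] IsColimit FullSub D (liftCocone D K s)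

  CreatesNonEmptyLimits : Set (lsuc 0ℓ ⊔ o ⊔ ℓ ⊔ e ⊔ p)
  CreatesNonEmptyLimits =
    ∀ (J : Category 0ℓ 0ℓ 0ℓ) → NonEmpty J → (D : Functor J FullSub)
      (K : Cone C (_∘incl_ D)) → IsLimit C (_∘incl_ D) K →
      Σ[ s ∈ S (Cone.apex K) ] IsLimit FullSub D (liftCone D K s)

  CreatesEpis : Set (o ⊔ ℓ ⊔ e ⊔ p)
  CreatesEpis =
    ∀ (X Y : Σ Obj S) (f : proj₁ X ⇒ proj₁ Y) →
      IsEpi FullSub {X} {Y} f ⇔ IsEpi C f

record Groupoid : Set₁ where
  infixr 9 _∘_
  field
    Obj : Set
    Hom : Obj → Obj → Set
    id  : ∀ {a} → Hom a a
    _∘_ : ∀ {a b c} → Hom b c → Hom a b → Hom a c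
    _⁻¹ : ∀ {a b} → Hom a b → Hom b a
    assoc     : ∀ {a b c d} (h : Hom c d) (g : Hom b c) (f : Hom a b) →
                (h ∘ g) ∘ f ≡ h ∘ (g ∘ f)
    identityˡ : ∀ {a b} (f : Hom a b) → id ∘ f ≡ f
    identityʳ : ∀ {a b} (f : Hom a b) → f ∘ id ≡ f
    inverseˡ  : ∀ {a b} (f : Hom a b) → (f ⁻¹) ∘ f ≡ id
    inverseʳ  : ∀ {a b} (f : Hom a b) → f ∘ (f ⁻¹) ≡ id

module _ (𝔸 : Groupoid) where
  open Groupoid 𝔸

  End : Obj → Set
  End a = Hom a a

  record Subgroup (a : Obj) : Set₁ where
    field
      mem   : End a → Set
      id∈   : mem id
      ∘∈    : ∀ {α β} → mem α → mem β → mem (α ∘ β)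
      inv∈  : ∀ {α} → mem α → mem (α ⁻¹)
  open Subgroup public

  Orthogonal : ∀ {a} → Subgroup a → Subgroup a → Set
  Orthogonal H K = ∀ α → mem H α → mem K α → α ≡ id

  record Kit : Set₂ where
    field
      _∋_  : (a : Obj) → Subgroup a → Set₁
      ext  : ∀ {a} (H K : Subgroup a) → (∀ γ → mem K γ ⇔ mem H γ) →
             a ∋ H → a ∋ K
      conj : ∀ {a b} (β : Hom a b) (H : Subgroup a) (K : Subgroup b) →
             (∀ γ → mem K γ ⇔ mem H (((β ⁻¹) ∘ γ) ∘ β)) →
             a ∋ H → b ∋ K

  Perp : ∀ {a} → (Subgroup a → Set₁) → (Subgroup a → Set₁)
  Perp P H = ∀ K → P K → Orthogonal H K

  Boolean : Kit → Set₁
  Boolean 𝒜 = ∀ a (H : Subgroup a) →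
    (a ∋ H → Perp (Perp (a ∋_)) H) × (Perp (Perp (a ∋_)) H → a ∋ H)
    where open Kit 𝒜

  record Presheaf : Set₁ where
    field
      F      : Obj → Setoid 0ℓ 0ℓ
    ∣_∣ : Obj → Set
    ∣ a ∣ = Setoid.Carrier (F a)
    field
      act    : ∀ {a b} → Hom b a → ∣ a ∣ → ∣ b ∣
      act-cong : ∀ {a b} (α : Hom b a) {x y : ∣ a ∣} →
                 Setoid._≈_ (F a) x y → Setoid._≈_ (F b) (act α x) (act α y)
      act-id : ∀ {a} (x : ∣ a ∣) → Setoid._≈_ (F a) (act id x) x
      act-∘  : ∀ {a b c} (α : Hom b a) (β : Hom c b) (x : ∣ a ∣) →
               Setoid._≈_ (F c) (act (α ∘ β) x) (act β (act α x))

  record _⇒P_ (X Y : Presheaf) : Set where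
    private
      module X = Presheaf X
      module Y = Presheaf Y
    field
      η       : ∀ a → X.∣ a ∣ → Y.∣ a ∣
      η-cong  : ∀ a {x y} → Setoid._≈_ (X.F a) x y →
                Setoid._≈_ (Y.F a) (η a x) (η a y)
      natural : ∀ {a b} (α : Hom b a) (x : X.∣ a ∣) →
                Setoid._≈_ (Y.F b) (η b (X.act α x)) (Y.act α (η a x))
  open _⇒P_ public

  PSh : Category (lsuc 0ℓ) 0ℓ 0ℓ
  PSh = record
    { Obj = Presheaf
    ; _⇒_ = _⇒P_
    ; _≈_ = λ {X} {Y} f g → ∀ a x → Setoid._≈_ (Presheaf.F Y a) (η f a x) (η g a x)
    ; id = λ {X} → record
        { η = λ a x → x
        ; η-cong = λ a p → p
        ; natural = λ α x → Setoid.refl (Presheaf.F X _)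
        }
    ; _∘_ = λ {X} {Y} {Z} g f → record
        { η = λ a x → η g a (η f a x)
        ; η-cong = λ a p → η-cong g a (η-cong f a p)
        ; natural = λ α x → Setoid.trans (Presheaf.F Z _)
            (η-cong g _ (natural f α x)) (natural g α (η f _ x))
        }
    ; equiv = λ {X} {Y} → record
        { refl = λ a x → Setoid.refl (Presheaf.F Y a)
        ; sym = λ p a x → Setoid.sym (Presheaf.F Y a) (p a x)
        ; trans = λ p q a x → Setoid.trans (Presheaf.F Y a) (p a x) (q a x)
        }
    ; assoc = λ {D = D} a x → Setoid.refl (Presheaf.F D a)
    ; identityˡ = λ {B = B} a x → Setoid.refl (Presheaf.F B a)
    ; identityʳ = λ {B = B} a x → Setoid.refl (Presheaf.F B a)
    ; ∘-resp-≈ = λ {C = C} {f = f} {h} {g} {i} p q a x →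
        Setoid.trans (Presheaf.F C a) (η-cong f a (q a x)) (p a (η i a x))
    }

  stab : (X : Presheaf) {a : Obj} → Presheaf.∣_∣ X a → Subgroup a
  stab X {a} x = record
    { mem  = λ α → Setoid._≈_ (F a) (act α x) x
    ; id∈  = act-id x
    ; ∘∈   = λ {α} {β} p q →
        Setoid.trans (F a) (act-∘ α β x) (Setoid.trans (F a) (act-cong β p) q)
    ; inv∈ = λ {α} p →
        Setoid.trans (F a) (act-cong (α ⁻¹) (Setoid.sym (F a) p))
          (Setoid.trans (F a) (Setoid.sym (F a) (act-∘ α (α ⁻¹) x))
            (subst (λ g → Setoid._≈_ (F a) (act g x) x)
                   (Relation.Binary.PropositionalEquality.sym (inverseʳ α))
                   (act-id x)))
    }
    where open Presheaf X

  Stable : Kit → Presheaf → Set₁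
  Stable 𝒜 X = ∀ a (x : Presheaf.∣_∣ X a) → Kit._∋_ 𝒜 a (stab X x)

  StPSh : Kit → Category (lsuc 0ℓ) 0ℓ 0ℓ
  StPSh 𝒜 = FullSub PSh (Stable 𝒜)

-- In a Boolean kit 𝒜 = 𝒜^⊥⊥ a subgroup belongs to 𝒜(a) as soon as each of its elements lies in
-- some member of 𝒜(a), since then it meets every member of 𝒜^⊥ trivially. In particular a presheaf
-- is stable when it maps to a stable one, because a natural map can only enlarge stabilizers. The
-- apex of a colimit in PSh maps to the canonical construction of that colimit, whose stabilizers
-- are covered by stabilizers of the diagram (for filtered colimits: after coequalizing the two
-- legs that identify x·α with x), and the apex of a non-empty limit maps to any of its vertices.
-- For epimorphisms, doubling the codomain along the image of f gives a stable presheaf on which the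
-- two inclusions agree after f, so an epimorphism of stable presheaves is surjective.
module Submission where

open import Level using (Level; 0ℓ; _⊔_) renaming (suc to lsuc)
open import Data.Bool using (Bool; true; false)
open import Data.Product using (Σ; Σ-syntax; _×_; _,_; proj₁; proj₂)
open import Data.Sum as Sum using (_⊎_; inj₁; inj₂)
open import Relation.Binary.Bundles using (Setoid)
open import Relation.Binary.PropositionalEquality as ≡ using (_≡_)
import Relation.Binary.Reasoning.Setoid as SetoidReasoning
open import Function.Bundles using (mk⇔)
open import Defs

module _ {o ℓ e p : Level} (C : Category o ℓ e) (S : Category.Obj C → Set p) where
  open Category C

  ClosedUnderIsos : Set (o ⊔ ℓ ⊔ e ⊔ p)
  ClosedUnderIsos = ∀ (X : Σ Obj S) (Y : Obj) (f : proj₁ X ⇒ Y) → IsIso C f → S Y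

  ClosedUnderCoproducts : Set (lsuc 0ℓ ⊔ o ⊔ ℓ ⊔ e ⊔ p)
  ClosedUnderCoproducts =
    ∀ (I : Set) (X : I → Σ Obj S) (K : CoproductCocone C I (λ i → proj₁ (X i))) →
      IsCoproduct C K → S (CoproductCocone.apex K)

  ClosedUnderFilteredColimits : Set (lsuc 0ℓ ⊔ o ⊔ ℓ ⊔ e ⊔ p)
  ClosedUnderFilteredColimits =
    ∀ (J : Category 0ℓ 0ℓ 0ℓ) → Filtered J → (D : Functor J (FullSub C S))
      (K : Cocone C (_∘incl_ C S D)) → IsColimit C (_∘incl_ C S D) K → S (Cocone.apex K)

  ClosedUnderNonEmptyLimits : Set (lsuc 0ℓ ⊔ o ⊔ ℓ ⊔ e ⊔ p)
  ClosedUnderNonEmptyLimits =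
    ∀ (J : Category 0ℓ 0ℓ 0ℓ) → NonEmpty J → (D : Functor J (FullSub C S))
      (K : Cone C (_∘incl_ C S D)) → IsLimit C (_∘incl_ C S D) K → S (Cone.apex K)

  -- In each case the universal property in the full subcategory is an instance of the one in C.

  closed⇒createsIsos : ClosedUnderIsos → CreatesIsos C S
  closed⇒createsIsos closed X Y f iso = closed X Y f iso , iso

  closed⇒createsCoproducts : ClosedUnderCoproducts → CreatesCoproducts C S
  closed⇒createsCoproducts closed I X K coproduct =
    closed I X K coproduct , λ L →
      coproduct (record { apex = proj₁ (CoproductCocone.apex L) ; inj = CoproductCocone.inj L })

  closed⇒createsFilteredColimits : ClosedUnderFilteredColimits → CreatesFilteredColimits C S
  closed⇒createsFilteredColimits closed J filtered D K colimit =
    closed J filtered D K colimit , λ L →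
      colimit (record { apex = proj₁ (Cocone.apex L) ; ψ = Cocone.ψ L ; commute = Cocone.commute L })

  closed⇒createsNonEmptyLimits : ClosedUnderNonEmptyLimits → CreatesNonEmptyLimits C S
  closed⇒createsNonEmptyLimits closed J j₀ D K limit =
    closed J j₀ D K limit , λ L →
      limit (record { apex = proj₁ (Cone.apex L) ; π = Cone.π L ; commute = Cone.commute L })

module _ (𝔸 : Groupoid) where
  open Groupoid 𝔸 using (Obj; Hom)

  private
    module P (X : Presheaf 𝔸) {a : Obj} = Setoid (Presheaf.F X a)

  stab-⊆-η : {X Y : Presheaf 𝔸} (f : _⇒P_ 𝔸 X Y) {a : Obj} (x : Presheaf.∣ X ∣ a) →
             ∀ α → mem (stab 𝔸 X x) α → mem (stab 𝔸 Y (η f a x)) α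
  stab-⊆-η {Y = Y} f x α fixes = P.trans Y (P.sym Y (natural f α x)) (η-cong f _ fixes)

  module Coproduct {I : Set} (X : I → Presheaf 𝔸) where

    Elem : Obj → Set
    Elem a = Σ[ i ∈ I ] Presheaf.∣ X i ∣ a

    data _∼_ {a : Obj} : Elem a → Elem a → Set where
      same : ∀ {i x y} → P._≈_ (X i) x y → (i , x) ∼ (i , y)

    ∼⇒≈ : ∀ {a i} {x y : Presheaf.∣ X i ∣ a} → (i , x) ∼ (i , y) → P._≈_ (X i) x y
    ∼⇒≈ (same e) = e

    ∐ : Presheaf 𝔸
    ∐ = record
      { F = λ a → record
          { Carrier = Elem a
          ; _≈_ = _∼_
          ; isEquivalence = record
              { refl = λ { {i , x} → same (P.refl (X i)) }
              ; sym = λ { (same {i} e) → same (P.sym (X i) e) }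
              ; trans = λ { (same {i} e) (same e′) → same (P.trans (X i) e e′) }
              }
          }
      ; act = λ { α (i , x) → i , Presheaf.act (X i) α x }
      ; act-cong = λ { α (same {i} e) → same (Presheaf.act-cong (X i) α e) }
      ; act-id = λ { (i , x) → same (Presheaf.act-id (X i) x) }
      ; act-∘ = λ { α β (i , x) → same (Presheaf.act-∘ (X i) α β x) }
      }

    cocone : CoproductCocone (PSh 𝔸) I X
    cocone = record
      { apex = ∐
      ; inj = λ i → record
          { η = λ a x → i , x
          ; η-cong = λ a → same
          ; natural = λ α x → same (P.refl (X i))
          }
      }

  module FilteredColimit {J : Category 0ℓ 0ℓ 0ℓ} (filtered : Filtered J) (D : Functor J (PSh 𝔸)) where
    private
      module J = Category J
      module D = Functor D
    open Filtered filtered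

    ∣_∣ : J.Obj → Obj → Set
    ∣ j ∣ a = Presheaf.∣ D.F₀ j ∣ a

    ap : ∀ {j k} (f : j J.⇒ k) {a} → ∣ j ∣ a → ∣ k ∣ a
    ap f x = η (D.F₁ f) _ x

    ap-∘₂ : ∀ {j k l m} (h : l J.⇒ m) (g : k J.⇒ l) (f : j J.⇒ k) {a} (x : ∣ j ∣ a) →
            P._≈_ (D.F₀ m) (ap (h J.∘ (g J.∘ f)) x) (ap h (ap g (ap f x)))
    ap-∘₂ h g f {a} x =
      P.trans (D.F₀ _) (D.homomorphism a x) (η-cong (D.F₁ h) a (D.homomorphism a x))

    Elem : Obj → Set
    Elem a = Σ[ j ∈ J.Obj ] ∣ j ∣ a

    _∼_ : ∀ {a} → Elem a → Elem a → Set
    (j , x) ∼ (k , y) = Σ[ l ∈ J.Obj ] Σ[ f ∈ j J.⇒ l ] Σ[ g ∈ k J.⇒ l ] P._≈_ (D.F₀ l) (ap f x) (ap g y)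

    ≈⇒∼ : ∀ {a j} {x y : ∣ j ∣ a} → P._≈_ (D.F₀ j) x y → (j , x) ∼ (j , y)
    ≈⇒∼ {a} {j} e = j , J.id , J.id , η-cong (D.F₁ J.id) a e

    ∼-sym : ∀ {a} {u v : Elem a} → u ∼ v → v ∼ u
    ∼-sym (l , f , g , e) = l , g , f , P.sym (D.F₀ l) e

    -- Join the two witnesses in a common upper bound, then coequalize the two maps out of the middle term.
    ∼-trans : ∀ {a} {u v w : Elem a} → u ∼ v → v ∼ w → u ∼ w
    ∼-trans {a} {j , x} {k , y} {m , z} (l₁ , f₁ , g₁ , e₁) (l₂ , f₂ , g₂ , e₂)
      with upper l₁ l₂
    ... | l₃ , h₁ , h₂ with coequal (h₁ J.∘ g₁) (h₂ J.∘ f₂)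
    ... | l₄ , h , c = l₄ , h J.∘ (h₁ J.∘ f₁) , h J.∘ (h₂ J.∘ g₂) , joined
      where
      open SetoidReasoning (Presheaf.F (D.F₀ l₄) a)
      joined : P._≈_ (D.F₀ l₄) (ap (h J.∘ (h₁ J.∘ f₁)) x) (ap (h J.∘ (h₂ J.∘ g₂)) z)
      joined = begin
        ap (h J.∘ (h₁ J.∘ f₁)) x   ≈⟨ ap-∘₂ h h₁ f₁ x ⟩
        ap h (ap h₁ (ap f₁ x))     ≈⟨ η-cong (D.F₁ h) a (η-cong (D.F₁ h₁) a e₁) ⟩
        ap h (ap h₁ (ap g₁ y))     ≈⟨ ap-∘₂ h h₁ g₁ y ⟨
        ap (h J.∘ (h₁ J.∘ g₁)) y   ≈⟨ D.F-resp-≈ c a y ⟩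
        ap (h J.∘ (h₂ J.∘ f₂)) y   ≈⟨ ap-∘₂ h h₂ f₂ y ⟩
        ap h (ap h₂ (ap f₂ y))     ≈⟨ η-cong (D.F₁ h) a (η-cong (D.F₁ h₂) a e₂) ⟩
        ap h (ap h₂ (ap g₂ z))     ≈⟨ ap-∘₂ h h₂ g₂ z ⟨
        ap (h J.∘ (h₂ J.∘ g₂)) z   ∎

    act : ∀ {a b} → Hom b a → Elem a → Elem b
    act α (j , x) = j , Presheaf.act (D.F₀ j) α x

    act-cong : ∀ {a b} (α : Hom b a) {u v : Elem a} → u ∼ v → act α u ∼ act α v
    act-cong {a} {b} α {j , x} {k , y} (l , f , g , e) = l , f , g , (begin
      ap f (Presheaf.act (D.F₀ j) α x)   ≈⟨ natural (D.F₁ f) α x ⟩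
      Presheaf.act (D.F₀ l) α (ap f x)   ≈⟨ Presheaf.act-cong (D.F₀ l) α e ⟩
      Presheaf.act (D.F₀ l) α (ap g y)   ≈⟨ natural (D.F₁ g) α y ⟨
      ap g (Presheaf.act (D.F₀ k) α y)   ∎)
      where open SetoidReasoning (Presheaf.F (D.F₀ l) b)

    colim : Presheaf 𝔸
    colim = record
      { F = λ a → record
          { Carrier = Elem a
          ; _≈_ = _∼_
          ; isEquivalence = record
              { refl = λ { {j , x} → ≈⇒∼ (P.refl (D.F₀ j)) }
              ; sym = ∼-sym
              ; trans = ∼-trans
              }
          }
      ; act = act
      ; act-cong = act-cong
      ; act-id = λ { (j , x) → ≈⇒∼ (Presheaf.act-id (D.F₀ j) x) }
      ; act-∘ = λ { α β (j , x) → ≈⇒∼ (Presheaf.act-∘ (D.F₀ j) α β x) }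
      }

    cocone : Cocone (PSh 𝔸) D
    cocone = record
      { apex = colim
      ; ψ = λ j → record
          { η = λ a x → j , x
          ; η-cong = λ a → ≈⇒∼
          ; natural = λ α x → ≈⇒∼ (P.refl (D.F₀ j))
          }
      ; commute = λ {j} {k} f a x → k , J.id , f , D.identity a (ap f x)
      }

  record Subpresheaf (Y : Presheaf 𝔸) : Set₁ where
    field
      holds      : ∀ {a} → Presheaf.∣ Y ∣ a → Set
      holds-resp : ∀ {a} {y y′ : Presheaf.∣ Y ∣ a} → P._≈_ Y y y′ → holds y → holds y′
      holds-act  : ∀ {a b} (α : Hom b a) {y : Presheaf.∣ Y ∣ a} → holds y → holds (Presheaf.act Y α y)

  image : {X Y : Presheaf 𝔸} → _⇒P_ 𝔸 X Y → Subpresheaf Y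
  image {X} {Y} f = record
    { holds = λ {a} y → Σ[ x ∈ Presheaf.∣ X ∣ a ] P._≈_ Y (η f a x) y
    ; holds-resp = λ e (x , fx≈y) → x , P.trans Y fx≈y e
    ; holds-act = λ α (x , fx≈y) →
        Presheaf.act X α x , P.trans Y (natural f α x) (Presheaf.act-cong Y α fx≈y)
    }

  -- Two copies of Y, tagged by a Bool, glued along the subpresheaf.
  module Double (Y : Presheaf 𝔸) (Z : Subpresheaf Y) where
    open Subpresheaf Z

    Elem : Obj → Set
    Elem a = Bool × Presheaf.∣ Y ∣ a

    _∼_ : ∀ {a} → Elem a → Elem a → Set
    (s , y) ∼ (t , y′) = P._≈_ Y y y′ × (s ≡ t ⊎ holds y)

    ∼-trans : ∀ {a} {u v w : Elem a} → u ∼ v → v ∼ w → u ∼ w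
    ∼-trans (e , inj₁ s≡t) (e′ , inj₁ t≡r) = P.trans Y e e′ , inj₁ (≡.trans s≡t t≡r)
    ∼-trans (e , inj₁ _)   (e′ , inj₂ z)   = P.trans Y e e′ , inj₂ (holds-resp (P.sym Y e) z)
    ∼-trans (e , inj₂ z)   (e′ , _)        = P.trans Y e e′ , inj₂ z

    doubled : Presheaf 𝔸
    doubled = record
      { F = λ a → record
          { Carrier = Elem a
          ; _≈_ = _∼_
          ; isEquivalence = record
              { refl = P.refl Y , inj₁ ≡.refl
              ; sym = λ { (e , inj₁ s≡t) → P.sym Y e , inj₁ (≡.sym s≡t)
                        ; (e , inj₂ z) → P.sym Y e , inj₂ (holds-resp e z) }
              ; trans = ∼-trans
              }
          }
      ; act = λ α (s , y) → s , Presheaf.act Y α y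
      ; act-cong = λ α (e , side) → Presheaf.act-cong Y α e , Sum.map₂ (holds-act α) side
      ; act-id = λ (s , y) → Presheaf.act-id Y y , inj₁ ≡.refl
      ; act-∘ = λ α β (s , y) → Presheaf.act-∘ Y α β y , inj₁ ≡.refl
      }

    copy : Bool → _⇒P_ 𝔸 Y doubled
    copy s = record
      { η = λ a y → s , y
      ; η-cong = λ a e → e , inj₁ ≡.refl
      ; natural = λ α y → P.refl Y , inj₁ ≡.refl
      }

    copies-agree⇒full : Category._≈_ (PSh 𝔸) (copy true) (copy false) → ∀ a (y : Presheaf.∣ Y ∣ a) → holds y
    copies-agree⇒full agree a y with agree a y
    ... | _ , inj₁ ()
    ... | _ , inj₂ z = z

  surjective⇒epi : {X Y : Presheaf 𝔸} (f : _⇒P_ 𝔸 X Y) →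
                   (∀ a y → Subpresheaf.holds (image f) {a} y) → IsEpi (PSh 𝔸) f
  surjective⇒epi {Y = Y} f surjective {Z} g h gf≈hf a y with surjective a y
  ... | x , fx≈y = begin
    η g a y         ≈⟨ η-cong g a fx≈y ⟨
    η g a (η f a x) ≈⟨ gf≈hf a x ⟩
    η h a (η f a x) ≈⟨ η-cong h a fx≈y ⟩
    η h a y         ∎
    where open SetoidReasoning (Presheaf.F Z a)

  module _ (𝒜 : Kit 𝔸) (boolean : Boolean 𝔸 𝒜) where
    open Kit 𝒜 using (_∋_)

    ∋-if-covered : ∀ {a} (H : Subgroup 𝔸 a) →
                   (∀ α → mem H α → Σ[ K ∈ Subgroup 𝔸 a ] (a ∋ K × mem K α)) → a ∋ H
    ∋-if-covered H covered = proj₂ (boolean _ H) λ K K⊥𝒜 α α∈H α∈K →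
      let (L , L∈𝒜 , α∈L) = covered α α∈H in K⊥𝒜 L L∈𝒜 α α∈K α∈L

    ∋-⊆ : ∀ {a} {H K : Subgroup 𝔸 a} → (∀ α → mem H α → mem K α) → a ∋ K → a ∋ H
    ∋-⊆ {K = K} H⊆K K∈𝒜 = ∋-if-covered _ λ α α∈H → K , K∈𝒜 , H⊆K α α∈H

    Stable-⇒ : {X Y : Presheaf 𝔸} → _⇒P_ 𝔸 X Y → Stable 𝔸 𝒜 Y → Stable 𝔸 𝒜 X
    Stable-⇒ f stableY a x = ∋-⊆ (stab-⊆-η f x) (stableY a (η f a x))

    ∐-stable : {I : Set} (X : I → Presheaf 𝔸) → (∀ i → Stable 𝔸 𝒜 (X i)) →
               Stable 𝔸 𝒜 (Coproduct.∐ X)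
    ∐-stable X stableX a (i , x) = ∋-⊆ (λ α → Coproduct.∼⇒≈ X) (stableX i a x)

    colim-stable : {J : Category 0ℓ 0ℓ 0ℓ} (filtered : Filtered J) (D : Functor J (PSh 𝔸)) →
                   (∀ j → Stable 𝔸 𝒜 (Functor.F₀ D j)) → Stable 𝔸 𝒜 (FilteredColimit.colim filtered D)
    colim-stable {J} filtered D stableD a (j , x) = ∋-if-covered _ covered
      where
      module J = Category J
      module D = Functor D
      open FilteredColimit filtered D using (ap)
      fixed : ∀ {α l m} (f g : j J.⇒ l) → P._≈_ (D.F₀ l) (ap f (Presheaf.act (D.F₀ j) α x)) (ap g x) →
              (h : l J.⇒ m) → h J.∘ f J.≈ h J.∘ g → mem (stab 𝔸 (D.F₀ m) (ap (h J.∘ f) x)) α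
      fixed {α} {m = m} f g e h hf≈hg = begin
        Presheaf.act (D.F₀ m) α (ap (h J.∘ f) x) ≈⟨ natural (D.F₁ (h J.∘ f)) α x ⟨
        ap (h J.∘ f) (Presheaf.act (D.F₀ j) α x) ≈⟨ D.homomorphism a _ ⟩
        ap h (ap f (Presheaf.act (D.F₀ j) α x))  ≈⟨ η-cong (D.F₁ h) a e ⟩
        ap h (ap g x)                            ≈⟨ D.homomorphism a x ⟨
        ap (h J.∘ g) x                           ≈⟨ D.F-resp-≈ hf≈hg a x ⟨
        ap (h J.∘ f) x                           ∎
        where open SetoidReasoning (Presheaf.F (D.F₀ m) a)

      covered : ∀ α → mem (stab 𝔸 (FilteredColimit.colim filtered D) (j , x)) α →
                Σ[ K ∈ Subgroup 𝔸 a ] (a ∋ K × mem K α)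
      covered α (l , f , g , e) with Filtered.coequal filtered f g
      ... | m , h , hf≈hg = stab 𝔸 (D.F₀ m) (ap (h J.∘ f) x) , stableD m a _ , fixed f g e h hf≈hg

    doubled-stable : (Y : Presheaf 𝔸) (Z : Subpresheaf Y) → Stable 𝔸 𝒜 Y →
                     Stable 𝔸 𝒜 (Double.doubled Y Z)
    doubled-stable Y Z stableY a (s , y) = ∋-⊆ (λ α → proj₁) (stableY a y)

    closedUnderIsos : ClosedUnderIsos (PSh 𝔸) (Stable 𝔸 𝒜)
    closedUnderIsos (X , stableX) Y f (f⁻¹ , _) = Stable-⇒ f⁻¹ stableX

    closedUnderNonEmptyLimits : ClosedUnderNonEmptyLimits (PSh 𝔸) (Stable 𝔸 𝒜)
    closedUnderNonEmptyLimits J j₀ D K _ = Stable-⇒ (Cone.π K j₀) (proj₂ (Functor.F₀ D j₀))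

    closedUnderCoproducts : ClosedUnderCoproducts (PSh 𝔸) (Stable 𝔸 𝒜)
    closedUnderCoproducts I X K coproduct =
      Stable-⇒ (proj₁ (coproduct (Coproduct.cocone X′))) (∐-stable X′ (λ i → proj₂ (X i)))
      where
      X′ : I → Presheaf 𝔸
      X′ i = proj₁ (X i)

    closedUnderFilteredColimits : ClosedUnderFilteredColimits (PSh 𝔸) (Stable 𝔸 𝒜)
    closedUnderFilteredColimits J filtered D K colimit =
      Stable-⇒ (proj₁ (colimit (FilteredColimit.cocone filtered D′)))
               (colim-stable filtered D′ (λ j → proj₂ (Functor.F₀ D j)))
      where
      D′ : Functor J (PSh 𝔸)
      D′ = _∘incl_ (PSh 𝔸) (Stable 𝔸 𝒜) D

    createsEpis : CreatesEpis (PSh 𝔸) (Stable 𝔸 𝒜)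
    createsEpis (X , stableX) (Y , stableY) f = mk⇔ epi⇒surjective-epi (λ epi g h → epi g h)
      where
      open Double Y (image f)
      epi⇒surjective-epi : IsEpi (StPSh 𝔸 𝒜) {X , stableX} {Y , stableY} f → IsEpi (PSh 𝔸) f
      epi⇒surjective-epi epi = surjective⇒epi f (copies-agree⇒full
        (epi {doubled , doubled-stable Y (image f) stableY} (copy true) (copy false)
             (λ a x → P.refl Y , inj₂ (x , P.refl Y))))

corollary7p12 : (𝔸 : Groupoid) (𝒜 : Kit 𝔸) → Boolean 𝔸 𝒜 →
    CreatesIsos (PSh 𝔸) (Stable 𝔸 𝒜)
    × CreatesCoproducts (PSh 𝔸) (Stable 𝔸 𝒜)
    × CreatesFilteredColimits (PSh 𝔸) (Stable 𝔸 𝒜)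
    × CreatesEpis (PSh 𝔸) (Stable 𝔸 𝒜)
    × CreatesNonEmptyLimits (PSh 𝔸) (Stable 𝔸 𝒜)
corollary7p12 𝔸 𝒜 boolean =
  closed⇒createsIsos (PSh 𝔸) (Stable 𝔸 𝒜) (closedUnderIsos 𝔸 𝒜 boolean) ,
  closed⇒createsCoproducts (PSh 𝔸) (Stable 𝔸 𝒜) (closedUnderCoproducts 𝔸 𝒜 boolean) ,
  closed⇒createsFilteredColimits (PSh 𝔸) (Stable 𝔸 𝒜) (closedUnderFilteredColimits 𝔸 𝒜 boolean) ,
  createsEpis 𝔸 𝒜 boolean ,
  closed⇒createsNonEmptyLimits (PSh 𝔸) (Stable 𝔸 𝒜) (closedUnderNonEmptyLimits 𝔸 𝒜 boolean)
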